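{- Let $n \geq 2$ and let $P_n=u_0u_1\dots u_n$ be the path with $n$ edges. For every walk $W$ of $P_n$, there exists a walk of $P_n$ equivalent to $W$ which follows a walk $S$ of the form $S=u_iu_{i-1}\dots u_mu_{m+1}\dots u_Mu_{M-1}\dots u_{j}$ for some indices $m \leq i\le j \leq M$.
   Context: A walk of a graph is a sequence of vertices in which consecutive vertices are adjacent (vertices and edges may repeat). Two walks are equivalent if their underlying multisets of traversed edges are equal. Given a walk $W=w_0w_1\dots w_l$, a walk $W'$ follows $W$ if there are nonnegative integers $i_0,\dots,i_{l-1}$ such that $W'=w_0(w_1w_0)^{i_0}w_1(w_2w_1)^{i_1}\dots w_{l-1}(w_lw_{l-1})^{i_{l-1}}w_l$, where $(w_{t+1}w_t)^{i}$ denotes inserting $i$ back-and-forth traversals (half-turns) along the edge $w_tw_{t+1}$. -}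

module Defs where

open import Data.Nat using (ℕ; zero; suc; _+_; _≤_; _⊓_)
open import Data.List using (List; []; _∷_; _++_; [_]; concat; replicate; drop)
open import Data.Sum using (_⊎_)
open import Data.Unit using (⊤)
open import Data.Product using (_×_)
open import Relation.Binary.PropositionalEquality using (_≡_)

-- The path P_n = u_0 u_1 … u_n : vertex u_k is represented by the natural k (k ≤ n).

Adj : ℕ → ℕ → ℕ → Set
Adj n a b = a ≤ n × b ≤ n × (suc a ≡ b ⊎ suc b ≡ a)

IsWalk : ℕ → List ℕ → Set
IsWalk n [] = Data.Empty.⊥ where import Data.Empty
IsWalk n (a ∷ []) = a ≤ n
IsWalk n (a ∷ b ∷ ws) = Adj n a b × IsWalk n (b ∷ ws)

-- the edge u_k u_{k+1} of P_n is represented by k (the smaller endpoint)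
-- edgeList W : the traversed edges of W, with multiplicity
edgeList : List ℕ → List ℕ
edgeList [] = []
edgeList (a ∷ []) = []
edgeList (a ∷ b ∷ ws) = (a ⊓ b) ∷ edgeList (b ∷ ws)

open import Data.List.Relation.Binary.Permutation.Propositional using (_↭_)

Equivalent : List ℕ → List ℕ → Set
Equivalent W W' = edgeList W ↭ edgeList W'

halfTurns : ℕ → ℕ → ℕ → List ℕ
halfTurns b a i = concat (replicate i (b ∷ a ∷ []))

-- Follows W' W : W' = w₀ (w₁w₀)^{i₀} w₁ (w₂w₁)^{i₁} w₂ … w_{l-1} (w_l w_{l-1})^{i_{l-1}} w_l
data Follows : List ℕ → List ℕ → Set where
  single : ∀ w → Follows [ w ] [ w ]
  step   : ∀ {w₀ w₁ W' W} (i : ℕ) → Follows (w₁ ∷ W') (w₁ ∷ W) →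
           Follows (w₀ ∷ halfTurns w₁ w₀ i ++ (w₁ ∷ W')) (w₀ ∷ w₁ ∷ W)

desc : ℕ → ℕ → List ℕ
desc b zero = [ b ]
desc b (suc k) = (b + suc k) ∷ desc b k

asc : ℕ → ℕ → List ℕ
asc b zero = [ b ]
asc b (suc k) = b ∷ asc (suc b) k

-- S = u_i u_{i-1} … u_m u_{m+1} … u_M u_{M-1} … u_j   (for m ≤ i ≤ j ≤ M)
open import Data.Nat using (_∸_)
zigzag : (m i j M : ℕ) → List ℕ
zigzag m i j M = desc m (i ∸ m) ++ drop 1 (asc m (M ∸ m)) ++ drop 1 (desc j (M ∸ j))

-- Read the walk backwards from its last vertex. At every stage its edge multiset is that of a
-- zigzag u_i … u_m … u_M … u_j, one of whose ends u_i, u_j is the current first vertex, plus some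
-- edges of u_m … u_M counted twice more: prepending a step at that end moves the end (and m or M
-- with it) by one, possibly leaving one more edge with two surplus traversals. Every edge counted
-- twice more lies on the ascending run u_m … u_M, where a half-turn realises it.
module Submission where

open import Defs
open import Data.Empty using (⊥-elim)
open import Data.List using (List; []; _∷_; _++_; [_]; drop; head; last; replicate)
open import Data.List.Properties using (++-assoc)
open import Data.List.Membership.Propositional using (_∈_)
open import Data.List.Membership.Propositional.Properties using (∈-++⁺ˡ; ∈-++⁺ʳ)
open import Data.List.Relation.Binary.Permutation.Propositional
  using (_↭_; prep; ↭-refl; ↭-sym; ↭-trans; ↭-reflexive; module PermutationReasoning)
open import Data.List.Relation.Binary.Permutation.Propositional.Properties
  using (shift; ++⁺; ++⁺ˡ; ++⁺ʳ; ∈-resp-↭)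
open import Data.List.Relation.Unary.All as All using (All; []; _∷_)
open import Data.List.Relation.Unary.Any using (here; there)
open import Data.Maybe using (just)
open import Data.Nat using (ℕ; zero; suc; _+_; _∸_; _≤_; _<_; _⊓_)
open import Data.Nat.Properties
open import Data.Product using (Σ; ∃; _×_; _,_; map; map₁; map₂; uncurry)
open import Data.Sum using (_⊎_; inj₁; inj₂)
open import Function using (id)
open import Relation.Binary.PropositionalEquality
  using (_≡_; refl; sym; trans; cong; cong₂; subst; module ≡-Reasoning)

consecutive : ℕ → ℕ → List ℕ
consecutive a zero    = []
consecutive a (suc k) = a ∷ consecutive (suc a) k

-- The edges of the subpath u_a … u_b; empty when b ≤ a.
interval : ℕ → ℕ → List ℕ
interval a b = consecutive a (b ∸ a)

consecutive-snoc : ∀ a k → consecutive a (suc k) ↭ a + k ∷ consecutive a k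
consecutive-snoc a zero    = ↭-reflexive (cong [_] (sym (+-identityʳ a)))
consecutive-snoc a (suc k) = begin
  a ∷ consecutive (suc a) (suc k)          <⟨ consecutive-snoc (suc a) k ⟩
  a ∷ suc a + k ∷ consecutive (suc a) k    <<⟨ ↭-refl ⟩
  suc a + k ∷ a ∷ consecutive (suc a) k    ≡⟨ cong (_∷ consecutive a (suc k)) (sym (+-suc a k)) ⟩
  a + suc k ∷ consecutive a (suc k)        ∎
  where open PermutationReasoning

∈-consecutive : ∀ {a k} t → a ≤ k → k < a + t → k ∈ consecutive a t
∈-consecutive {a} {k} zero    a≤k k<a+0 = ⊥-elim (≤⇒≯ a≤k (subst (k <_) (+-identityʳ a) k<a+0))
∈-consecutive {a} {k} (suc t) a≤k k<a+t with m≤n⇒m<n∨m≡n a≤k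
... | inj₁ a<k  = there (∈-consecutive t a<k (subst (k <_) (+-suc a t) k<a+t))
... | inj₂ refl = here refl

interval-empty : ∀ a → interval a a ≡ []
interval-empty a = cong (consecutive a) (n∸n≡0 a)

interval-cons : ∀ {a b} → a < b → interval a b ≡ a ∷ interval (suc a) b
interval-cons a<b = cong (consecutive _) (+-∸-assoc 1 a<b)

interval-snoc : ∀ {a b} → a ≤ b → interval a (suc b) ↭ b ∷ interval a b
interval-snoc {a} {b} a≤b = begin
  consecutive a (suc b ∸ a)            ≡⟨ cong (consecutive a) (+-∸-assoc 1 a≤b) ⟩
  consecutive a (suc (b ∸ a))          ↭⟨ consecutive-snoc a (b ∸ a) ⟩
  a + (b ∸ a) ∷ consecutive a (b ∸ a)  ≡⟨ cong (_∷ interval a b) (m+[n∸m]≡n a≤b) ⟩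
  b ∷ interval a b                     ∎
  where open PermutationReasoning

∈-interval : ∀ {a b k} → a ≤ k → k < b → k ∈ interval a b
∈-interval {a} {b} {k} a≤k k<b =
  ∈-consecutive (b ∸ a) a≤k (subst (k <_) (sym (m+[n∸m]≡n (≤-trans a≤k (<⇒≤ k<b)))) k<b)

zigzagEdges : ℕ → ℕ → ℕ → ℕ → List ℕ
zigzagEdges m i j M = interval m i ++ interval m M ++ interval j M

zigzagEdges-upper : ∀ {m i j M} → j < M → zigzagEdges m i j M ↭ j ∷ zigzagEdges m i (suc j) M
zigzagEdges-upper {m} {i} {j} {M} j<M = begin
  interval m i ++ interval m M ++ interval j M
    ≡⟨ cong (λ xs → interval m i ++ interval m M ++ xs) (interval-cons j<M) ⟩
  interval m i ++ interval m M ++ j ∷ interval (suc j) M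
    ↭⟨ ++⁺ˡ (interval m i) (shift j (interval m M) (interval (suc j) M)) ⟩
  interval m i ++ j ∷ interval m M ++ interval (suc j) M
    ↭⟨ shift j (interval m i) (interval m M ++ interval (suc j) M) ⟩
  j ∷ zigzagEdges m i (suc j) M ∎
  where open PermutationReasoning

zigzagEdges-lower : ∀ {m i j M} → m ≤ i → zigzagEdges m (suc i) j M ↭ i ∷ zigzagEdges m i j M
zigzagEdges-lower {m} {i} {j} {M} m≤i = ++⁺ʳ (interval m M ++ interval j M) (interval-snoc m≤i)

zigzagEdges-top : ∀ {m i M} → m ≤ M → zigzagEdges m i (suc M) (suc M) ↭ M ∷ zigzagEdges m i M M
zigzagEdges-top {m} {i} {M} m≤M = begin
  interval m i ++ interval m (suc M) ++ interval (suc M) (suc M)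
    ≡⟨ cong (λ xs → interval m i ++ interval m (suc M) ++ xs) (interval-empty (suc M)) ⟩
  interval m i ++ interval m (suc M) ++ []
    ↭⟨ ++⁺ˡ (interval m i) (++⁺ʳ [] (interval-snoc m≤M)) ⟩
  interval m i ++ M ∷ interval m M ++ []
    ↭⟨ shift M (interval m i) (interval m M ++ []) ⟩
  M ∷ interval m i ++ interval m M ++ []
    ≡⟨ cong (λ xs → M ∷ interval m i ++ interval m M ++ xs) (interval-empty M) ⟨
  M ∷ zigzagEdges m i M M ∎
  where open PermutationReasoning

zigzagEdges-bottom : ∀ {m j M} → m < M → zigzagEdges m m j M ≡ m ∷ zigzagEdges (suc m) (suc m) j M
zigzagEdges-bottom {m} {j} {M} m<M = begin
  interval m m ++ interval m M ++ interval j M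
    ≡⟨ cong (_++ interval m M ++ interval j M) (interval-empty m) ⟩
  interval m M ++ interval j M
    ≡⟨ cong (_++ interval j M) (interval-cons m<M) ⟩
  m ∷ interval (suc m) M ++ interval j M
    ≡⟨ cong (λ xs → m ∷ xs ++ interval (suc m) M ++ interval j M) (interval-empty (suc m)) ⟨
  m ∷ zigzagEdges (suc m) (suc m) j M ∎
  where open ≡-Reasoning

zigzagEdges-point : ∀ v → zigzagEdges v v v v ≡ []
zigzagEdges-point v rewrite interval-empty v = refl

Adj-sym : ∀ {n a b} → Adj n a b → Adj n b a
Adj-sym (a≤n , b≤n , inj₁ eq) = b≤n , a≤n , inj₂ eq
Adj-sym (a≤n , b≤n , inj₂ eq) = b≤n , a≤n , inj₁ eq

isWalk-∷ : ∀ {n x y ys} → Adj n x y → head ys ≡ just y → IsWalk n ys → IsWalk n (x ∷ ys)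
isWalk-∷ {ys = _ ∷ _} adj refl walk = adj , walk

edgeList-∷ : ∀ {x y} ys → head ys ≡ just y → edgeList (x ∷ ys) ≡ x ⊓ y ∷ edgeList ys
edgeList-∷ (_ ∷ _) refl = refl

last-∷ : ∀ {v : ℕ} x ys → last ys ≡ just v → last (x ∷ ys) ≡ just v
last-∷ x (_ ∷ _) eq = eq

isWalk-++-drop : ∀ {n} xs ys → last xs ≡ head ys → IsWalk n xs → IsWalk n ys →
  IsWalk n (xs ++ drop 1 ys)
isWalk-++-drop (_ ∷ [])     (_ ∷ _) refl _            walk = walk
isWalk-++-drop (_ ∷ x ∷ xs) ys      eq   (adj , walk) ys-walk =
  adj , isWalk-++-drop (x ∷ xs) ys eq walk ys-walk

edgeList-++-drop : ∀ xs ys → last xs ≡ head ys → edgeList (xs ++ drop 1 ys) ≡ edgeList xs ++ edgeList ys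
edgeList-++-drop []           []      refl = refl
edgeList-++-drop (_ ∷ [])     (_ ∷ _) refl = refl
edgeList-++-drop (y ∷ x ∷ xs) ys      eq   = cong (y ⊓ x ∷_) (edgeList-++-drop (x ∷ xs) ys eq)

last-++-drop : ∀ (xs ys : List ℕ) → last xs ≡ head ys → last (xs ++ drop 1 ys) ≡ last ys
last-++-drop []           []      refl = refl
last-++-drop (_ ∷ [])     (_ ∷ _) refl = refl
last-++-drop (_ ∷ x ∷ xs) ys      eq   = last-++-drop (x ∷ xs) ys eq

head-asc : ∀ b k → head (asc b k) ≡ just b
head-asc b zero    = refl
head-asc b (suc k) = refl

last-asc : ∀ b k → last (asc b k) ≡ just (b + k)
last-asc b zero    = cong just (sym (+-identityʳ b))
last-asc b (suc k) = last-∷ b (asc (suc b) k) (trans (last-asc (suc b) k) (cong just (sym (+-suc b k))))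

head-desc : ∀ b k → head (desc b k) ≡ just (b + k)
head-desc b zero    = cong just (sym (+-identityʳ b))
head-desc b (suc k) = refl

last-desc : ∀ b k → last (desc b k) ≡ just b
last-desc b zero    = refl
last-desc b (suc k) = last-∷ (b + suc k) (desc b k) (last-desc b k)

isWalk-asc : ∀ {n} b k → b + k ≤ n → IsWalk n (asc b k)
isWalk-asc     b zero    b+0≤n   = subst (_≤ _) (+-identityʳ b) b+0≤n
isWalk-asc {n} b (suc k) b+1+k≤n = isWalk-∷ adj (head-asc (suc b) k) (isWalk-asc (suc b) k 1+b+k≤n)
  where
    1+b+k≤n : suc b + k ≤ n
    1+b+k≤n = subst (_≤ n) (+-suc b k) b+1+k≤n
    1+b≤n : suc b ≤ n
    1+b≤n = ≤-trans (m≤m+n (suc b) k) 1+b+k≤n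
    adj : Adj n b (suc b)
    adj = ≤-trans (n≤1+n b) 1+b≤n , 1+b≤n , inj₁ refl

isWalk-desc : ∀ {n} b k → b + k ≤ n → IsWalk n (desc b k)
isWalk-desc     b zero    b+0≤n   = subst (_≤ _) (+-identityʳ b) b+0≤n
isWalk-desc {n} b (suc k) b+1+k≤n = isWalk-∷ adj (head-desc b k) (isWalk-desc b k b+k≤n)
  where
    b+k≤n : b + k ≤ n
    b+k≤n = ≤-trans (+-monoʳ-≤ b (n≤1+n k)) b+1+k≤n
    adj : Adj n (b + suc k) (b + k)
    adj = b+1+k≤n , b+k≤n , inj₂ (sym (+-suc b k))

edgeList-asc : ∀ b k → edgeList (asc b k) ≡ consecutive b k
edgeList-asc b zero    = refl
edgeList-asc b (suc k) =
  trans (edgeList-∷ (asc (suc b) k) (head-asc (suc b) k))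
        (cong₂ _∷_ (m≤n⇒m⊓n≡m (n≤1+n b)) (edgeList-asc (suc b) k))

edgeList-desc : ∀ b k → edgeList (desc b k) ↭ consecutive b k
edgeList-desc b zero    = ↭-refl
edgeList-desc b (suc k) = begin
  edgeList (b + suc k ∷ desc b k)
    ≡⟨ edgeList-∷ (desc b k) (head-desc b k) ⟩
  (b + suc k) ⊓ (b + k) ∷ edgeList (desc b k)
    ≡⟨ cong (_∷ edgeList (desc b k)) (m≥n⇒m⊓n≡n (+-monoʳ-≤ b (n≤1+n k))) ⟩
  b + k ∷ edgeList (desc b k)
    ↭⟨ prep (b + k) (edgeList-desc b k) ⟩
  b + k ∷ consecutive b k
    ↭⟨ consecutive-snoc b k ⟨
  consecutive b (suc k) ∎
  where open PermutationReasoning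

module _ {m i j M : ℕ} (m≤i : m ≤ i) (i≤j : i ≤ j) (j≤M : j ≤ M) where
  private
    m≤M : m ≤ M
    m≤M = ≤-trans m≤i (≤-trans i≤j j≤M)

    lower upward upper : List ℕ
    lower  = desc m (i ∸ m)
    upward = asc m (M ∸ m)
    upper  = desc j (M ∸ j)

    lower-upward : last lower ≡ head upward
    lower-upward = trans (last-desc m (i ∸ m)) (sym (head-asc m (M ∸ m)))

    lower-upward-upper : last (lower ++ drop 1 upward) ≡ head upper
    lower-upward-upper = begin
      last (lower ++ drop 1 upward)  ≡⟨ last-++-drop lower upward lower-upward ⟩
      last upward                    ≡⟨ last-asc m (M ∸ m) ⟩
      just (m + (M ∸ m))             ≡⟨ cong just (trans (m+[n∸m]≡n m≤M) (sym (m+[n∸m]≡n j≤M))) ⟩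
      just (j + (M ∸ j))             ≡⟨ head-desc j (M ∸ j) ⟨
      head upper                     ∎
      where open ≡-Reasoning

    zigzag-assoc : zigzag m i j M ≡ (lower ++ drop 1 upward) ++ drop 1 upper
    zigzag-assoc = sym (++-assoc lower (drop 1 upward) (drop 1 upper))

  isWalk-zigzag : ∀ {n} → M ≤ n → IsWalk n (zigzag m i j M)
  isWalk-zigzag {n} M≤n = subst (IsWalk n) (sym zigzag-assoc)
    (isWalk-++-drop (lower ++ drop 1 upward) upper lower-upward-upper
      (isWalk-++-drop lower upward lower-upward (isWalk-desc m (i ∸ m) (bounded m≤i i≤M))
                                                (isWalk-asc m (M ∸ m) (bounded m≤M ≤-refl)))
      (isWalk-desc j (M ∸ j) (bounded j≤M ≤-refl)))
    where
      i≤M : i ≤ M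
      i≤M = ≤-trans i≤j j≤M
      bounded : ∀ {a b} → a ≤ b → b ≤ M → a + (b ∸ a) ≤ n
      bounded a≤b b≤M = subst (_≤ n) (sym (m+[n∸m]≡n a≤b)) (≤-trans b≤M M≤n)

  edgeList-zigzag : edgeList (zigzag m i j M) ↭ zigzagEdges m i j M
  edgeList-zigzag = begin
    edgeList (zigzag m i j M)
      ≡⟨ cong edgeList zigzag-assoc ⟩
    edgeList ((lower ++ drop 1 upward) ++ drop 1 upper)
      ≡⟨ edgeList-++-drop (lower ++ drop 1 upward) upper lower-upward-upper ⟩
    edgeList (lower ++ drop 1 upward) ++ edgeList upper
      ≡⟨ cong (_++ edgeList upper) (edgeList-++-drop lower upward lower-upward) ⟩
    (edgeList lower ++ edgeList upward) ++ edgeList upper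
      ≡⟨ ++-assoc (edgeList lower) (edgeList upward) (edgeList upper) ⟩
    edgeList lower ++ edgeList upward ++ edgeList upper
      ↭⟨ ++⁺ (edgeList-desc m (i ∸ m))
             (++⁺ (↭-reflexive (edgeList-asc m (M ∸ m))) (edgeList-desc j (M ∸ j))) ⟩
    zigzagEdges m i j M ∎
    where open PermutationReasoning

  ∈-zigzag : ∀ {e} → m ≤ e → e < M → e ∈ edgeList (zigzag m i j M)
  ∈-zigzag m≤e e<M =
    ∈-resp-↭ (↭-sym edgeList-zigzag) (∈-++⁺ʳ (interval m i) (∈-++⁺ˡ (∈-interval m≤e e<M)))

doubled : List ℕ → List ℕ
doubled []       = []
doubled (e ∷ es) = e ∷ e ∷ doubled es

shift-pair : ∀ xs {e : ℕ} ys → xs ++ e ∷ e ∷ ys ↭ e ∷ e ∷ xs ++ ys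
shift-pair xs {e} ys = ↭-trans (shift e xs (e ∷ ys)) (prep e (shift e xs ys))

halfTurns-isWalk : ∀ {n a b} i R → Adj n a b → IsWalk n (b ∷ R) →
  IsWalk n (a ∷ halfTurns b a i ++ b ∷ R)
halfTurns-isWalk zero    R adj walk = adj , walk
halfTurns-isWalk (suc i) R adj walk = adj , Adj-sym adj , halfTurns-isWalk i R adj walk

Follows-isWalk : ∀ {n W S} → Follows W S → IsWalk n S → IsWalk n W
Follows-isWalk (single w) walk         = walk
Follows-isWalk (step i f) (adj , walk) = halfTurns-isWalk i _ adj (Follows-isWalk f walk)

follows-refl : ∀ v P → Follows (v ∷ P) (v ∷ P)
follows-refl v []      = single v
follows-refl v (w ∷ P) = step 0 (follows-refl w P)

edgeList-halfTurns : ∀ a b i R →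
  edgeList (a ∷ halfTurns b a i ++ R) ≡ doubled (replicate i (a ⊓ b)) ++ edgeList (a ∷ R)
edgeList-halfTurns a b zero    R = refl
edgeList-halfTurns a b (suc i) R =
  cong₂ (λ e es → a ⊓ b ∷ e ∷ es) (⊓-comm b a) (edgeList-halfTurns a b i R)

add-halfTurn : ∀ {v P S e} → Follows (v ∷ P) S → e ∈ edgeList S →
  ∃ λ P′ → Follows (v ∷ P′) S × edgeList (v ∷ P′) ↭ e ∷ e ∷ edgeList (v ∷ P)
add-halfTurn (step {w₀} {w₁} {W′} i f) (here refl) =
  halfTurns w₁ w₀ (suc i) ++ w₁ ∷ W′ , step (suc i) f ,
  prep (w₀ ⊓ w₁) (↭-reflexive (cong (_∷ edgeList (w₀ ∷ halfTurns w₁ w₀ i ++ w₁ ∷ W′)) (⊓-comm w₁ w₀)))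
add-halfTurn {e = e} (step {w₀} {w₁} {W′} i f) (there e∈) with add-halfTurn f e∈
... | P′ , f′ , P′↭ = T ++ w₁ ∷ P′ , step i f′ , (begin
  edgeList (w₀ ∷ T ++ w₁ ∷ P′)  ≡⟨ edgeList-halfTurns w₀ w₁ i (w₁ ∷ P′) ⟩
  H ++ a ∷ edgeList (w₁ ∷ P′)   ↭⟨ ++⁺ˡ H (prep a P′↭) ⟩
  H ++ a ∷ e ∷ e ∷ E            ↭⟨ ++⁺ˡ H (shift-pair [ a ] E) ⟩
  H ++ e ∷ e ∷ a ∷ E            ↭⟨ shift-pair H (a ∷ E) ⟩
  e ∷ e ∷ H ++ a ∷ E            ≡⟨ cong (λ es → e ∷ e ∷ es) (edgeList-halfTurns w₀ w₁ i (w₁ ∷ W′)) ⟨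
  e ∷ e ∷ edgeList (w₀ ∷ T ++ w₁ ∷ W′) ∎)
  where
    open PermutationReasoning
    a : ℕ
    a = w₀ ⊓ w₁
    T H E : List ℕ
    T = halfTurns w₁ w₀ i
    H = doubled (replicate i a)
    E = edgeList (w₁ ∷ W′)

add-halfTurns : ∀ {v P D} → All (_∈ edgeList (v ∷ P)) D →
  ∃ λ P′ → Follows (v ∷ P′) (v ∷ P) × edgeList (v ∷ P′) ↭ doubled D ++ edgeList (v ∷ P)
add-halfTurns {v} {P} []           = P , follows-refl v P , ↭-refl
add-halfTurns         (e∈ ∷ D⊆S) with add-halfTurns D⊆S
... | P₁ , f₁ , P₁↭ with add-halfTurn f₁ e∈
... | P₂ , f₂ , P₂↭ = P₂ , f₂ , ↭-trans P₂↭ (prep _ (prep _ P₁↭))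

follows-doubled : ∀ {n D} S → IsWalk n S → All (_∈ edgeList S) D →
  ∃ λ W → Follows W S × edgeList W ↭ doubled D ++ edgeList S
follows-doubled (v ∷ P) _ D⊆S = map (v ∷_) id (add-halfTurns D⊆S)

absorb : ∀ {e Z Z′} D → e ∷ Z ↭ Z′ → e ∷ doubled D ++ Z ↭ doubled D ++ Z′
absorb {e} {Z} D e∷Z↭Z′ = ↭-trans (↭-sym (shift e (doubled D) Z)) (++⁺ˡ (doubled D) e∷Z↭Z′)

pair-up : ∀ {e Z Z′} D → Z ↭ e ∷ Z′ → e ∷ doubled D ++ Z ↭ doubled (e ∷ D) ++ Z′
pair-up {e} {Z} {Z′} D Z↭e∷Z′ = prep e (↭-trans (++⁺ˡ (doubled D) Z↭e∷Z′) (shift e (doubled D) Z′))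

-- Stands for the edges of a walk of P_n that follows zigzag m i j M with one half-turn added on
-- each edge of extra.
record NormalForm (n : ℕ) : Set where
  constructor normalForm
  field
    m i j M     : ℕ
    m≤i         : m ≤ i
    i≤j         : i ≤ j
    j≤M         : j ≤ M
    M≤n         : M ≤ n
    extra       : List ℕ
    extra-range : All (λ e → m ≤ e × e < M) extra

  edges : List ℕ
  edges = doubled extra ++ zigzagEdges m i j M

module NF = NormalForm
open NormalForm using (edges)

Endpoint : ∀ {n} → NormalForm n → ℕ → Set
Endpoint nf s = s ≡ NF.i nf ⊎ s ≡ NF.j nf

Extension : ∀ {n} → NormalForm n → ℕ → ℕ → Set
Extension {n} nf e s = Σ (NormalForm n) λ nf′ → Endpoint nf′ s × e ∷ edges nf ↭ edges nf′

up-from-j : ∀ {n} (nf : NormalForm n) → suc (NF.j nf) ≤ n → Extension nf (NF.j nf) (suc (NF.j nf))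
up-from-j (normalForm m i j M m≤i i≤j j≤M M≤n E E-range) j<n with m≤n⇒m<n∨m≡n j≤M
... | inj₁ j<M =
  normalForm m i (suc j) M m≤i (m≤n⇒m≤1+n i≤j) j<M M≤n (j ∷ E) ((≤-trans m≤i i≤j , j<M) ∷ E-range) ,
  inj₂ refl , pair-up E (zigzagEdges-upper {m} {i} j<M)
... | inj₂ refl =
  normalForm m i (suc j) (suc j) m≤i (m≤n⇒m≤1+n i≤j) ≤-refl j<n E (All.map (map₂ m<n⇒m<1+n) E-range) ,
  inj₂ refl , absorb E (↭-sym (zigzagEdges-top (≤-trans m≤i i≤j)))

down-from-i : ∀ {n s} (nf : NormalForm n) → suc s ≡ NF.i nf → Extension nf s s
down-from-i {s = s} (normalForm m _ j M m≤i i≤j j≤M M≤n E E-range) refl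
  with s≤j ← ≤-trans (n≤1+n s) i≤j
  with s<M ← ≤-trans i≤j j≤M
  with m≤n⇒m<n∨m≡n m≤i
... | inj₁ m<1+s =
  normalForm m s j M m≤s s≤j j≤M M≤n (s ∷ E) ((m≤s , s<M) ∷ E-range) ,
  inj₁ refl , pair-up E (zigzagEdges-lower m≤s)
  where m≤s = m<1+n⇒m≤n m<1+s
... | inj₂ refl =
  normalForm s s j M ≤-refl s≤j j≤M M≤n E (All.map (map₁ <⇒≤) E-range) ,
  inj₁ refl , absorb E (↭-reflexive (sym (zigzagEdges-bottom s<M)))

up : ∀ {n s} (nf : NormalForm n) → Endpoint nf s → suc s ≤ n → Extension nf s (suc s)
up nf (inj₂ refl) s<n = up-from-j nf s<n
up nf@(normalForm m i j M m≤i i≤j j≤M M≤n E E-range) (inj₁ refl) s<n with m≤n⇒m<n∨m≡n i≤j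
... | inj₁ i<j =
  normalForm m (suc i) j M (m≤n⇒m≤1+n m≤i) i<j j≤M M≤n E E-range ,
  inj₁ refl , absorb E (↭-sym (zigzagEdges-lower m≤i))
... | inj₂ refl = up-from-j nf s<n

down : ∀ {n s} (nf : NormalForm n) → Endpoint nf (suc s) → Extension nf s s
down nf (inj₁ s+1≡i) = down-from-i nf s+1≡i
down {s = s} nf@(normalForm m i j M m≤i i≤j j≤M M≤n E E-range) (inj₂ refl) with m≤n⇒m<n∨m≡n i≤j
... | inj₁ i<j =
  normalForm m i s M m≤i (m<1+n⇒m≤n i<j) (≤-trans (n≤1+n s) j≤M) M≤n E E-range ,
  inj₂ refl , absorb E (↭-sym (zigzagEdges-upper {m} {i} j≤M))
... | inj₂ refl = down-from-i nf refl

prepend : ∀ {n w x} (nf : NormalForm n) → Endpoint nf x → Adj n w x → Extension nf (w ⊓ x) w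
prepend {w = w} nf x∈ (_   , _ , inj₁ refl) rewrite m≤n⇒m⊓n≡m (n≤1+n w) = down nf x∈
prepend {x = x} nf x∈ (w≤n , _ , inj₂ refl) rewrite m≥n⇒m⊓n≡n (n≤1+n x) = up nf x∈ w≤n

normalise : ∀ {n} w W → IsWalk n (w ∷ W) →
  Σ (NormalForm n) λ nf → Endpoint nf w × edgeList (w ∷ W) ↭ edges nf
normalise w []      w≤n =
  normalForm w w w w ≤-refl ≤-refl ≤-refl w≤n [] [] , inj₁ refl , ↭-reflexive (sym (zigzagEdges-point w))
normalise w (x ∷ W) (adj , walk) with normalise x W walk
... | nf , x∈ , W↭ with prepend nf x∈ adj
... | nf′ , w∈ , nf↭ = nf′ , w∈ , ↭-trans (prep (w ⊓ x) W↭) nf↭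

lemma5p3 : (n : ℕ) → 2 ≤ n → (W : List ℕ) → IsWalk n W →
    Σ (List ℕ) (λ W' → IsWalk n W' × Equivalent W W' ×
      Σ ℕ (λ m → Σ ℕ (λ i → Σ ℕ (λ j → Σ ℕ (λ M →
        m ≤ i × i ≤ j × j ≤ M × M ≤ n × Follows W' (zigzag m i j M))))))
lemma5p3 n _ (w ∷ W) walk
  with normalForm m i j M m≤i i≤j j≤M M≤n E E-range , _ , W↭ ← normalise w W walk
  with S-walk ← isWalk-zigzag m≤i i≤j j≤M M≤n
  with W′ , W′-follows , W′↭ ← follows-doubled (zigzag m i j M) S-walk
                                 (All.map (uncurry (∈-zigzag m≤i i≤j j≤M)) E-range)
  = W′ , Follows-isWalk W′-follows S-walk , equivalent ,
    m , i , j , M , m≤i , i≤j , j≤M , M≤n , W′-follows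
  where
    open PermutationReasoning
    equivalent : Equivalent (w ∷ W) W′
    equivalent = begin
      edgeList (w ∷ W)                        ↭⟨ W↭ ⟩
      doubled E ++ zigzagEdges m i j M        ↭⟨ ++⁺ˡ (doubled E) (edgeList-zigzag m≤i i≤j j≤M) ⟨
      doubled E ++ edgeList (zigzag m i j M)  ↭⟨ W′↭ ⟨
      edgeList W′                             ∎
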